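{- Let $\Delta\subset\mathbb{R}^2$ be a lattice polygon with $\operatorname{lw}(\Delta)=d>0$. Let $P$ be a vertex of $\Delta$ and let $v\in\mathbb{Z}^2$ be a primitive vector. If $\operatorname{lw}_v(\Delta_P)<d$ and $\operatorname{lw}_v(\Delta_P)<\operatorname{lw}_v(\Delta)-1$, then $\Delta$ is unimodularly equivalent to $\Upsilon_{d-1}:=\operatorname{conv}\{(0,0),(1,d),(d,1)\}$.
   Context: A lattice polygon is the convex hull of finitely many points of $\mathbb{Z}^2$. For a lattice polygon $\Delta$ and a primitive vector $v\in\mathbb{Z}^2$, $\operatorname{lw}_v(\Delta)=\max_{Q\in\Delta}\langle Q,v\rangle-\min_{Q\in\Delta}\langle Q,v\rangle$, and $\operatorname{lw}(\Delta)=\min_v\operatorname{lw}_v(\Delta)$ over all non-zero primitive $v\in\mathbb{Z}^2$. For a vertex $P$ of $\Delta$, $\Delta_P:=\operatorname{conv}((\Delta\cap\mathbb{Z}^2)\setminus\{P\})$. Two lattice polygons are unimodularly equivalent if one is mapped onto the other by a map $x\mapsto Ax+b$ with $A\in\mathrm{GL}_2(\mathbb{Z})$, $b\in\mathbb{Z}^2$. -}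

module Defs where

open import Data.Nat as ℕ using (ℕ; zero; suc)
open import Data.Integer using (ℤ; +_; _+_; _-_; _*_; _≤_; _<_; -_; 0ℤ; 1ℤ)
open import Data.Integer.GCD using (gcd)
open import Data.Product using (Σ; ∃; _×_; _,_; proj₁; proj₂)
open import Data.Sum using (_⊎_)
open import Data.Vec using (Vec; []; _∷_)
open import Data.Vec.Relation.Unary.All using (All)
open import Data.Vec.Membership.Propositional using (_∈_)
open import Relation.Nullary using (¬_)
open import Relation.Binary.PropositionalEquality using (_≡_; _≢_)
open import Function.Bundles using (_⇔_)

Pt : Set
Pt = ℤ × ℤ

PtSet : Set₁
PtSet = Pt → Set

_·_ : Pt → Pt → ℤ
(a , b) · (c , e) = a * c + b * e

wsum : ∀ {n} → Vec ℕ n → Vec Pt n → Pt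
wsum [] [] = (0ℤ , 0ℤ)
wsum (c ∷ cs) ((x , y) ∷ ps) with wsum cs ps
... | (sx , sy) = ((+ c) * x + sx , (+ c) * y + sy)

total : ∀ {n} → Vec ℕ n → ℕ
total [] = 0
total (c ∷ cs) = c ℕ.+ total cs

-- A lattice point lies in the convex hull of lattice points iff it is a
-- convex combination with rational coefficients; clearing denominators,
-- iff there are finitely many points pᵢ ∈ A and weights cᵢ ∈ ℕ with
-- k = Σ cᵢ > 0 and Σ cᵢ pᵢ = k·Q.
InConv : PtSet → PtSet
InConv A (qx , qy) =
  Σ ℕ λ n → Σ (Vec Pt n) λ ps → Σ (Vec ℕ n) λ cs →
    All A ps × (0 ℕ.< total cs) ×
    (wsum cs ps ≡ ((+ total cs) * qx , (+ total cs) * qy))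

LatPts : ∀ {n} → Vec Pt (suc n) → PtSet
LatPts S = InConv (λ Q → Q ∈ S)

IsVertex : ∀ {n} → Vec Pt (suc n) → Pt → Set
IsVertex S P = (P ∈ S) × ¬ InConv (λ Q → (Q ∈ S) × (Q ≢ P)) P

LatPtsMinus : ∀ {n} → Vec Pt (suc n) → Pt → PtSet
LatPtsMinus S P = InConv (λ Q → LatPts S Q × (Q ≢ P))

Primitive : Pt → Set
Primitive (a , b) = gcd a b ≡ 1ℤ

-- lw_v of the lattice polygon whose lattice-point set is A equals w.
-- (For a lattice polygon the max/min of ⟨·,v⟩ is attained at a vertex,
-- which is a lattice point, so it suffices to range over lattice points.)
WidthIs : PtSet → Pt → ℤ → Set
WidthIs A v w =
  Σ Pt λ p → Σ Pt λ q → A p × A q ×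
    (∀ r → A r → (p · v ≤ r · v) × (r · v ≤ q · v)) ×
    (w ≡ q · v - p · v)

LwIs : PtSet → ℤ → Set
LwIs A d =
  (Σ Pt λ v → Primitive v × WidthIs A v d) ×
  (∀ v w → Primitive v → WidthIs A v w → d ≤ w)

-- Unimodular equivalence of two lattice polygons, via their lattice-point
-- sets (a lattice polygon is the convex hull of its lattice points):
-- x ↦ Mx + t with M = [[a,b],[c,e]], det M = ±1, maps A onto B.
UnimodEquiv : PtSet → PtSet → Set
UnimodEquiv A B =
  Σ ℤ λ a → Σ ℤ λ b → Σ ℤ λ c → Σ ℤ λ e → Σ Pt λ t →
    ((a * e - b * c ≡ 1ℤ) ⊎ (a * e - b * c ≡ - 1ℤ)) ×
    (∀ x y → A (x , y) ⇔ B (a * x + b * y + proj₁ t , c * x + e * y + proj₂ t))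

Upsilon : ℤ → Vec Pt 3
Upsilon d = (0ℤ , 0ℤ) ∷ (1ℤ , d) ∷ (d , 1ℤ) ∷ []

-- Move P to the origin and call Y the translated set of lattice points of Δ.  Removing P lowers
-- lw_v by at least two, so P is alone at one end of the range of levels: for ℓ = ±v every point
-- of Y other than 0 has level R · ℓ ∈ [L, L + w] with L ≥ 2 and w = lw_v(Δ_P) < d.
--
-- Call a unimodular coordinate system with weights b, c ≥ 1 a frame if in it the level is
-- b x + c y and every point of Y ∖ {0} has both coordinates ≥ 1.  A frame with b = c = 1 comes
-- from dividing a Bézout coordinate of one point by its level.  While b + c < L, the point
-- (1,1) has level b + c and so lies outside Y; by convexity Y ∖ {0} then lies strictly on one
-- side of the diagonal, and a shear of the coordinates gives a frame with larger b + c.  Once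
-- b + c ≥ L, the upper level bound forces x + y ≤ d + 1 on Y ∖ {0}.  Both coordinates are
-- minimised at the origin, so lw(Δ) = d gives points with x ≥ d and with y ≥ d, and these can
-- only be (d,1) and (1,d).  By convexity Y is then exactly {0} ∪ {x, y ≥ 1, x + y ≤ d + 1},
-- the lattice points of Υ_{d-1}.
module Submission where

open import Data.Empty using (⊥-elim)
open import Data.Integer as ℤ
  using (ℤ; +_; -[1+_]; _+_; _-_; _*_; -_; _≤_; _<_; 0ℤ; 1ℤ; -1ℤ; ∣_∣; +≤+; +<+; -≤+)
import Data.Integer.DivMod as DivMod
open import Data.Integer.GCD using (gcd; gcd[i,j]∣i; gcd[i,j]∣j)
import Data.Integer.Divisibility.Signed as DS
import Data.Integer.Properties as ℤP
open import Data.Integer.Tactic.RingSolver using (solve-∀)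
open import Data.Nat as ℕ using (ℕ; zero; suc; z≤n; s≤s)
open import Data.Nat.Coprimality using (coprime-Bézout; gcd≡1⇒coprime)
import Data.Nat.Divisibility as ℕDiv
import Data.Nat.GCD as ℕGCD
open ℕGCD using (module Bézout)
import Data.Nat.Properties as ℕP
import Data.Nat.Tactic.RingSolver as ℕSolver
open import Data.Product as Product using (Σ; _×_; _,_; proj₁; proj₂)
open import Data.Product.Properties using (≡-dec)
open import Data.Sum using (_⊎_; inj₁; inj₂)
open import Data.Vec using (Vec; []; _∷_; _++_; map)
open import Data.Vec.Membership.Propositional using (_∈_)
open import Data.Vec.Relation.Unary.All using (All; []; _∷_)
import Data.Vec.Relation.Unary.All.Properties as All
open import Data.Vec.Relation.Unary.Any using (here; there)
open import Function.Bundles using (_⇔_; mk⇔)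
open import Function.Construct.Composition using (_⇔-∘_)
open import Function.Construct.Symmetry using (⇔-sym)
open import Relation.Binary.Definitions using (DecidableEquality; tri<; tri≈; tri>)
open import Relation.Binary.PropositionalEquality
open import Relation.Nullary using (¬_; yes; no)

open import Defs

0≤i+j : ∀ {i j} → 0ℤ ≤ i → 0ℤ ≤ j → 0ℤ ≤ i + j
0≤i+j = ℤP.+-mono-≤

0≤i*j : ∀ {i j} → 0ℤ ≤ i → 0ℤ ≤ j → 0ℤ ≤ i * j
0≤i*j {+ m} {+ n} _ _ = subst (0ℤ ≤_) (ℤP.pos-* m n) (+≤+ z≤n)

0≤j-i : ∀ {i j} → i ≤ j → 0ℤ ≤ j - i
0≤j-i = ℤP.i≤j⇒0≤j-i

≤-byDifference : ∀ {i j} k → j - i ≡ k → 0ℤ ≤ k → i ≤ j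
≤-byDifference k refl 0≤k = ℤP.0≤i-j⇒j≤i 0≤k

1≤⇒0< : ∀ {i} → 1ℤ ≤ i → 0ℤ < i
1≤⇒0< = ℤP.suc[i]≤j⇒i<j

1≤⇒0≤ : ∀ {i} → 1ℤ ≤ i → 0ℤ ≤ i
1≤⇒0≤ = ℤP.≤-trans (+≤+ z≤n)

≰0⇒1≤ : ∀ {i} → ¬ (i ≤ 0ℤ) → 1ℤ ≤ i
≰0⇒1≤ i≰0 = ℤP.i<j⇒suc[i]≤j (ℤP.≰⇒> i≰0)

i<j⇒1≤j-i : ∀ {i j} → i < j → 1ℤ ≤ j - i
i<j⇒1≤j-i {i} {j} i<j = ≤-byDifference _ (shift i j) (0≤j-i (ℤP.i<j⇒suc[i]≤j i<j))
  where
  shift : ∀ i j → j - i - 1ℤ ≡ j - (1ℤ + i)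
  shift = solve-∀

i≤i+j : ∀ i {j} → 0ℤ ≤ j → i ≤ i + j
i≤i+j i {j} 0≤j = ≤-byDifference _ (shift i j) 0≤j
  where
  shift : ∀ i j → i + j - i ≡ j
  shift = solve-∀

i<i+j : ∀ i {j} → 1ℤ ≤ j → i < i + j
i<i+j i {j} 1≤j = ℤP.suc[i]≤j⇒i<j (≤-byDifference _ (shift i j) (0≤j-i 1≤j))
  where
  shift : ∀ i j → i + j - (1ℤ + i) ≡ j - 1ℤ
  shift = solve-∀

infixl 6 _⊕_ _⊖_
infixr 7 _⊛_

_⊕_ : Pt → Pt → Pt
(a , b) ⊕ (c , e) = (a + c , b + e)

_⊖_ : Pt → Pt → Pt
(a , b) ⊖ (c , e) = (a - c , b - e)

_⊛_ : ℤ → Pt → Pt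
k ⊛ (a , b) = (k * a , k * b)

neg : Pt → Pt
neg (a , b) = (- a , - b)

swapPt : Pt → Pt
swapPt (x , y) = (y , x)

origin : Pt
origin = (0ℤ , 0ℤ)

_≟ₚ_ : DecidableEquality Pt
_≟ₚ_ = ≡-dec ℤ._≟_ ℤ._≟_

⊕-comm : ∀ p q → p ⊕ q ≡ q ⊕ p
⊕-comm (a , b) (c , e) = cong₂ _,_ (ℤP.+-comm a c) (ℤP.+-comm b e)

⊕-origin : ∀ P → P ⊕ origin ≡ P
⊕-origin (a , b) = cong₂ _,_ (ℤP.+-identityʳ a) (ℤP.+-identityʳ b)

⊕-⊛origin : ∀ P l → P ⊕ l ⊛ origin ≡ P
⊕-⊛origin (x , y) l = cong₂ _,_ (vanish x) (vanish y)
  where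
  vanish : ∀ x → x + l * 0ℤ ≡ x
  vanish x = trans (cong (_+_ x) (ℤP.*-zeroʳ l)) (ℤP.+-identityʳ x)

⊕-⊖-cancel : ∀ P R → P ⊕ (R ⊖ P) ≡ R
⊕-⊖-cancel (a , b) (x , y) = cong₂ _,_ (cancel a x) (cancel b y)
  where
  cancel : ∀ a x → a + (x - a) ≡ x
  cancel = solve-∀

⊕-⊖-cancelʳ : ∀ P R → (P ⊕ R) ⊖ P ≡ R
⊕-⊖-cancelʳ (a , b) (x , y) = cong₂ _,_ (cancel a x) (cancel b y)
  where
  cancel : ∀ a x → a + x - a ≡ x
  cancel = solve-∀

⊕-≢ : ∀ {P R} → R ≢ origin → P ⊕ R ≢ P
⊕-≢ {P} {R} R≢0 eq = R≢0 (trans (sym (⊕-⊖-cancelʳ P R)) (trans (cong (_⊖ P) eq) (⊖-self P)))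
  where
  ⊖-self : ∀ P → P ⊖ P ≡ origin
  ⊖-self (a , b) = cong₂ _,_ (ℤP.+-inverseʳ a) (ℤP.+-inverseʳ b)

⊖-≢ : ∀ {P R} → R ≢ P → R ⊖ P ≢ origin
⊖-≢ {P} {R} R≢P eq = R≢P (trans (sym (⊕-⊖-cancel P R)) (trans (cong (P ⊕_) eq) (⊕-origin P)))

origin-· : ∀ u → origin · u ≡ 0ℤ
origin-· (a , b) = refl

·-⊕ : ∀ p q u → (p ⊕ q) · u ≡ p · u + q · u
·-⊕ (x , y) (x′ , y′) (a , b) = distrib x y x′ y′ a b
  where
  distrib : ∀ x y x′ y′ a b → (x + x′) * a + (y + y′) * b ≡ (x * a + y * b) + (x′ * a + y′ * b)
  distrib = solve-∀

·-⊖ : ∀ p q u → (p ⊖ q) · u ≡ p · u - q · u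
·-⊖ (x , y) (x′ , y′) (a , b) = distrib x y x′ y′ a b
  where
  distrib : ∀ x y x′ y′ a b → (x - x′) * a + (y - y′) * b ≡ (x * a + y * b) - (x′ * a + y′ * b)
  distrib = solve-∀

·-⊛ : ∀ k p u → (k ⊛ p) · u ≡ k * (p · u)
·-⊛ k (x , y) (a , b) = distrib k x y a b
  where
  distrib : ∀ k x y a b → k * x * a + k * y * b ≡ k * (x * a + y * b)
  distrib = solve-∀

·-⊕ʳ : ∀ R u v → R · (u ⊕ v) ≡ R · u + R · v
·-⊕ʳ (x , y) (a , b) (c , e) = distrib x y a b c e
  where
  distrib : ∀ x y a b c e → x * (a + c) + y * (b + e) ≡ (x * a + y * b) + (x * c + y * e)
  distrib = solve-∀

·-⊖ʳ : ∀ R u v → R · (u ⊖ v) ≡ R · u - R · v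
·-⊖ʳ (x , y) (a , b) (c , e) = distrib x y a b c e
  where
  distrib : ∀ x y a b c e → x * (a - c) + y * (b - e) ≡ (x * a + y * b) - (x * c + y * e)
  distrib = solve-∀

·-⊛ʳ : ∀ R k u → R · (k ⊛ u) ≡ k * (R · u)
·-⊛ʳ (x , y) k (a , b) = distrib x y k a b
  where
  distrib : ∀ x y k a b → x * (k * a) + y * (k * b) ≡ k * (x * a + y * b)
  distrib = solve-∀

·-neg : ∀ R v → R · neg v ≡ - (R · v)
·-neg (x , y) (a , b) = distrib x y a b
  where
  distrib : ∀ x y a b → x * - a + y * - b ≡ - (x * a + y * b)
  distrib = solve-∀

·-⊕-relative : ∀ P R u → (P ⊕ R) · u - P · u ≡ R · u
·-⊕-relative P R u = trans (cong (_- P · u) (·-⊕ P R u)) (cancel (P · u) (R · u))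
  where
  cancel : ∀ a b → a + b - a ≡ b
  cancel = solve-∀

linear : Pt → Pt → Pt → Pt
linear r₁ r₂ R = (R · r₁ , R · r₂)

-- Convex hulls of lattice points

record Combination (A : PtSet) (k : ℕ) (s : Pt) : Set where
  constructor combination
  field
    {size}  : ℕ
    points  : Vec Pt size
    weights : Vec ℕ size
    members : All A points
    total≡  : total weights ≡ k
    wsum≡   : wsum weights points ≡ s

wsum-++ : ∀ {m k} (cs : Vec ℕ m) (ps : Vec Pt m) (ds : Vec ℕ k) (qs : Vec Pt k) →
          wsum (cs ++ ds) (ps ++ qs) ≡ wsum cs ps ⊕ wsum ds qs
wsum-++ [] [] ds qs = cong₂ _,_ (sym (ℤP.+-identityˡ _)) (sym (ℤP.+-identityˡ _))
wsum-++ (c ∷ cs) ((x , y) ∷ ps) ds qs rewrite wsum-++ cs ps ds qs =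
  cong₂ _,_ (sym (ℤP.+-assoc (+ c * x) _ _)) (sym (ℤP.+-assoc (+ c * y) _ _))

total-++ : ∀ {m k} (cs : Vec ℕ m) (ds : Vec ℕ k) → total (cs ++ ds) ≡ total cs ℕ.+ total ds
total-++ [] ds = refl
total-++ (c ∷ cs) ds = trans (cong (c ℕ.+_) (total-++ cs ds)) (sym (ℕP.+-assoc c _ _))

wsum-scale : ∀ {m} j (cs : Vec ℕ m) (ps : Vec Pt m) → wsum (map (j ℕ.*_) cs) ps ≡ + j ⊛ wsum cs ps
wsum-scale j [] [] = cong₂ _,_ (sym (ℤP.*-zeroʳ (+ j))) (sym (ℤP.*-zeroʳ (+ j)))
wsum-scale j (c ∷ cs) ((x , y) ∷ ps) with wsum cs ps | wsum-scale j cs ps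
... | (sx , sy) | eq =
  cong₂ _,_ (trans (cong₂ _+_ (cong (_* x) (ℤP.pos-* j c)) (cong proj₁ eq)) (distrib (+ j) (+ c) x sx))
            (trans (cong₂ _+_ (cong (_* y) (ℤP.pos-* j c)) (cong proj₂ eq)) (distrib (+ j) (+ c) y sy))
  where
  distrib : ∀ a b x s → a * b * x + a * s ≡ a * (b * x + s)
  distrib = solve-∀

total-scale : ∀ {m} j (cs : Vec ℕ m) → total (map (j ℕ.*_) cs) ≡ j ℕ.* total cs
total-scale j [] = sym (ℕP.*-zeroʳ j)
total-scale j (c ∷ cs) = trans (cong (j ℕ.* c ℕ.+_) (total-scale j cs)) (sym (ℕP.*-distribˡ-+ j c _))

Combination-⊕ : ∀ {A k k′ s s′} → Combination A k s → Combination A k′ s′ → Combination A (k ℕ.+ k′) (s ⊕ s′)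
Combination-⊕ (combination ps cs as t e) (combination ps′ cs′ as′ t′ e′) =
  combination (ps ++ ps′) (cs ++ cs′) (All.++⁺ as as′)
    (trans (total-++ cs cs′) (cong₂ ℕ._+_ t t′)) (trans (wsum-++ cs ps cs′ ps′) (cong₂ _⊕_ e e′))

Combination-⊛ : ∀ {A k s} j → Combination A k s → Combination A (j ℕ.* k) (+ j ⊛ s)
Combination-⊛ j (combination ps cs as t e) =
  combination ps (map (j ℕ.*_) cs) as
    (trans (total-scale j cs) (cong (j ℕ.*_) t)) (trans (wsum-scale j cs ps) (cong (+ j ⊛_) e))

InConv⇒Combination : ∀ {A} Q → InConv A Q → Σ ℕ λ k → 0 ℕ.< k × Combination A k (+ k ⊛ Q)
InConv⇒Combination (qx , qy) (_ , ps , cs , as , 0<k , e) = total cs , 0<k , combination ps cs as refl e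

Combination⇒InConv : ∀ {A k} Q → 0 ℕ.< k → Combination A k (+ k ⊛ Q) → InConv A Q
Combination⇒InConv (qx , qy) 0<k (combination ps cs as refl e) = _ , ps , cs , as , 0<k , e

Combination-rescale : ∀ {A k K R} j → j ℕ.* k ≡ K → Combination A k (+ k ⊛ R) → Combination A K (+ K ⊛ R)
Combination-rescale {A} {k} {R = x , y} j refl c =
  subst (Combination A (j ℕ.* k)) (cong₂ _,_ (assoc x) (assoc y)) (Combination-⊛ j c)
  where
  assoc : ∀ x → + j * (+ k * x) ≡ + (j ℕ.* k) * x
  assoc x = trans (sym (ℤP.*-assoc (+ j) (+ k) x)) (cong (_* x) (sym (ℤP.pos-* j k)))

record Barycentre (l₁ l₂ l₃ : ℤ) (R₁ R₂ R₃ Z : Pt) : Set where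
  constructor barycentre
  field
    equation : (l₁ + l₂ + l₃) ⊛ Z ≡ l₁ ⊛ R₁ ⊕ l₂ ⊛ R₂ ⊕ l₃ ⊛ R₃

IsConvex : PtSet → Set
IsConvex Y = ∀ {R₁ R₂ R₃ Z} l₁ l₂ l₃ → 0ℤ ≤ l₁ → 0ℤ ≤ l₂ → 0ℤ ≤ l₃ → 0ℤ < l₁ + l₂ + l₃ →
  Barycentre l₁ l₂ l₃ R₁ R₂ R₃ Z → Y R₁ → Y R₂ → Y R₃ → Y Z

Barycentre-scale : ∀ K {l₁ l₂ l₃ R₁ R₂ R₃ Z} → Barycentre l₁ l₂ l₃ R₁ R₂ R₃ Z →
  l₁ ⊛ (K ⊛ R₁) ⊕ l₂ ⊛ (K ⊛ R₂) ⊕ l₃ ⊛ (K ⊛ R₃) ≡ ((l₁ + l₂ + l₃) * K) ⊛ Z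
Barycentre-scale K {l₁} {l₂} {l₃} {x₁ , y₁} {x₂ , y₂} {x₃ , y₃} {z₁ , z₂} (barycentre eq) =
  cong₂ _,_ (scale x₁ x₂ x₃ z₁ (cong proj₁ eq)) (scale y₁ y₂ y₃ z₂ (cong proj₂ eq))
  where
  open ≡-Reasoning
  scale : ∀ x₁ x₂ x₃ z → (l₁ + l₂ + l₃) * z ≡ l₁ * x₁ + l₂ * x₂ + l₃ * x₃ →
          l₁ * (K * x₁) + l₂ * (K * x₂) + l₃ * (K * x₃) ≡ (l₁ + l₂ + l₃) * K * z
  scale x₁ x₂ x₃ z h = begin
    l₁ * (K * x₁) + l₂ * (K * x₂) + l₃ * (K * x₃) ≡⟨ factor K l₁ l₂ l₃ x₁ x₂ x₃ ⟩
    K * (l₁ * x₁ + l₂ * x₂ + l₃ * x₃)             ≡⟨ cong (K *_) (sym h) ⟩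
    K * ((l₁ + l₂ + l₃) * z)                      ≡⟨ reorder K (l₁ + l₂ + l₃) z ⟩
    (l₁ + l₂ + l₃) * K * z                        ∎
    where
    factor : ∀ K l₁ l₂ l₃ x₁ x₂ x₃ →
             l₁ * (K * x₁) + l₂ * (K * x₂) + l₃ * (K * x₃) ≡ K * (l₁ * x₁ + l₂ * x₂ + l₃ * x₃)
    factor = solve-∀
    reorder : ∀ K l z → K * (l * z) ≡ l * K * z
    reorder = solve-∀

private
  0<m*n : ∀ {m n} → 0 ℕ.< m → 0 ℕ.< n → 0 ℕ.< m ℕ.* n
  0<m*n {suc _} {suc _} _ _ = s≤s z≤n

-- Rescale the three representations to the common total K = k₁ k₂ k₃, then add them with weights lᵢ.
InConv-convex : ∀ A → IsConvex (InConv A)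
InConv-convex A {R₁} {R₂} {R₃} {Z} _ _ _ (+≤+ {n = m₁} _) (+≤+ {n = m₂} _) (+≤+ {n = m₃} _) (ℤ.+<+ 0<M) eq in₁ in₂ in₃
  with InConv⇒Combination R₁ in₁ | InConv⇒Combination R₂ in₂ | InConv⇒Combination R₃ in₃
... | k₁ , 0<k₁ , c₁ | k₂ , 0<k₂ , c₂ | k₃ , 0<k₃ , c₃ =
  Combination⇒InConv Z (0<m*n 0<M (0<m*n (0<m*n 0<k₁ 0<k₂) 0<k₃)) (subst₂ (Combination A) total≡ sum≡ combined)
  where
  K = k₁ ℕ.* k₂ ℕ.* k₃
  M = m₁ ℕ.+ m₂ ℕ.+ m₃
  combined = Combination-⊕ (Combination-⊕
    (Combination-⊛ m₁ (Combination-rescale (k₂ ℕ.* k₃) (complement₁ k₁ k₂ k₃) c₁))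
    (Combination-⊛ m₂ (Combination-rescale (k₁ ℕ.* k₃) (complement₂ k₁ k₂ k₃) c₂)))
    (Combination-⊛ m₃ (Combination-rescale (k₁ ℕ.* k₂) refl c₃))
    where
    complement₁ : ∀ k₁ k₂ k₃ → k₂ ℕ.* k₃ ℕ.* k₁ ≡ k₁ ℕ.* k₂ ℕ.* k₃
    complement₁ = ℕSolver.solve-∀
    complement₂ : ∀ k₁ k₂ k₃ → k₁ ℕ.* k₃ ℕ.* k₂ ≡ k₁ ℕ.* k₂ ℕ.* k₃
    complement₂ = ℕSolver.solve-∀
  total≡ : m₁ ℕ.* K ℕ.+ m₂ ℕ.* K ℕ.+ m₃ ℕ.* K ≡ M ℕ.* K
  total≡ = distrib m₁ m₂ m₃ K
    where
    distrib : ∀ m₁ m₂ m₃ K → m₁ ℕ.* K ℕ.+ m₂ ℕ.* K ℕ.+ m₃ ℕ.* K ≡ (m₁ ℕ.+ m₂ ℕ.+ m₃) ℕ.* K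
    distrib = ℕSolver.solve-∀
  sum≡ : + m₁ ⊛ (+ K ⊛ R₁) ⊕ + m₂ ⊛ (+ K ⊛ R₂) ⊕ + m₃ ⊛ (+ K ⊛ R₃) ≡ + (M ℕ.* K) ⊛ Z
  sum≡ = trans (Barycentre-scale (+ K) eq) (cong (_⊛ Z) (sym (ℤP.pos-* M K)))

⊆-InConv : ∀ {A : PtSet} {Q} → A Q → InConv A Q
⊆-InConv {Q = x , y} a =
  1 , (x , y) ∷ [] , 1 ∷ [] , a ∷ [] , s≤s z≤n , cong₂ _,_ (ℤP.+-identityʳ _) (ℤP.+-identityʳ _)

InConv-inhabited : ∀ {A : PtSet} {Q} → InConv A Q → Σ Pt A
InConv-inhabited (zero , [] , [] , [] , () , _)
InConv-inhabited (suc _ , p ∷ _ , _ , a ∷ _ , _ , _) = p , a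

wsum-∷ : ∀ {m} c p (cs : Vec ℕ m) ps → wsum (c ∷ cs) (p ∷ ps) ≡ + c ⊛ p ⊕ wsum cs ps
wsum-∷ c (x , y) cs ps with wsum cs ps
... | _ = refl

wsum-≤ : ∀ {A : PtSet} {m} u C → (∀ p → A p → p · u ≤ C) →
         (cs : Vec ℕ m) (ps : Vec Pt m) → All A ps → wsum cs ps · u ≤ + total cs * C
wsum-≤ (a , b) C bound [] [] [] = ℤP.≤-refl
wsum-≤ u C bound (c ∷ cs) (p ∷ ps) (a ∷ as) = begin
  wsum (c ∷ cs) (p ∷ ps) · u       ≡⟨ cong (_· u) (wsum-∷ c p cs ps) ⟩
  (+ c ⊛ p ⊕ wsum cs ps) · u       ≡⟨ ·-⊕ (+ c ⊛ p) _ u ⟩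
  (+ c ⊛ p) · u + wsum cs ps · u   ≡⟨ cong (_+ wsum cs ps · u) (·-⊛ (+ c) p u) ⟩
  + c * (p · u) + wsum cs ps · u   ≤⟨ ℤP.+-mono-≤ (ℤP.*-monoˡ-≤-nonNeg (+ c) (bound p a)) (wsum-≤ u C bound cs ps as) ⟩
  + c * C + + total cs * C         ≡⟨ sym (ℤP.*-distribʳ-+ C (+ c) (+ total cs)) ⟩
  (+ c + + total cs) * C           ≡⟨ cong (_* C) (sym (ℤP.pos-+ c (total cs))) ⟩
  + total (c ∷ cs) * C             ∎
  where open ℤP.≤-Reasoning

InConv-≤ : ∀ {A : PtSet} u C → (∀ p → A p → p · u ≤ C) → ∀ {Q} → InConv A Q → Q · u ≤ C
InConv-≤ u C bound {Q} hQ with InConv⇒Combination Q hQ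
... | k , 0<k , combination ps cs as refl e =
  ℤP.*-cancelˡ-≤-pos _ _ (+ k) {{ℤ.positive (ℤ.+<+ 0<k)}}
    (subst (_≤ + k * C) (trans (cong (_· u) e) (·-⊛ (+ k) Q u)) (wsum-≤ u C bound cs ps as))

argmax : ∀ {n} (S : Vec Pt (suc n)) u → Σ Pt λ q → q ∈ S × (∀ p → p ∈ S → p · u ≤ q · u)
argmax (x ∷ []) u = x , here refl , λ { _ (here refl) → ℤP.≤-refl }
argmax (x ∷ y ∷ S) u with argmax (y ∷ S) u
... | q , q∈S , q-max with ℤP.≤-total (x · u) (q · u)
...   | inj₁ x≤q = q , there q∈S , λ { _ (here refl) → x≤q ; p (there p∈S) → q-max p p∈S }
...   | inj₂ q≤x = x , here refl , λ { _ (here refl) → ℤP.≤-refl ; p (there p∈S) → ℤP.≤-trans (q-max p p∈S) q≤x }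


-- Convex sets containing the origin

Barycentre-· : ∀ {l₁ l₂ l₃ R₁ R₂ R₃ Z} r → Barycentre l₁ l₂ l₃ R₁ R₂ R₃ Z →
  (l₁ + l₂ + l₃) * (Z · r) ≡ l₁ * (R₁ · r) + l₂ * (R₂ · r) + l₃ * (R₃ · r)
Barycentre-· {l₁} {l₂} {l₃} {x₁ , y₁} {x₂ , y₂} {x₃ , y₃} {z₁ , z₂} (a , b) (barycentre eq) = begin
  (l₁ + l₂ + l₃) * (z₁ * a + z₂ * b)                       ≡⟨ expand (l₁ + l₂ + l₃) z₁ z₂ a b ⟩
  (l₁ + l₂ + l₃) * z₁ * a + (l₁ + l₂ + l₃) * z₂ * b        ≡⟨ cong₂ (λ s t → s * a + t * b) (cong proj₁ eq) (cong proj₂ eq) ⟩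
  (l₁ * x₁ + l₂ * x₂ + l₃ * x₃) * a + (l₁ * y₁ + l₂ * y₂ + l₃ * y₃) * b
    ≡⟨ regroup l₁ l₂ l₃ x₁ x₂ x₃ y₁ y₂ y₃ a b ⟩
  l₁ * (x₁ * a + y₁ * b) + l₂ * (x₂ * a + y₂ * b) + l₃ * (x₃ * a + y₃ * b) ∎
  where
  open ≡-Reasoning
  expand : ∀ l z₁ z₂ a b → l * (z₁ * a + z₂ * b) ≡ l * z₁ * a + l * z₂ * b
  expand = solve-∀
  regroup : ∀ l₁ l₂ l₃ x₁ x₂ x₃ y₁ y₂ y₃ a b →
    (l₁ * x₁ + l₂ * x₂ + l₃ * x₃) * a + (l₁ * y₁ + l₂ * y₂ + l₃ * y₃) * b ≡
    l₁ * (x₁ * a + y₁ * b) + l₂ * (x₂ * a + y₂ * b) + l₃ * (x₃ * a + y₃ * b)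
  regroup = solve-∀

Barycentre-translate : ∀ {l₁ l₂ l₃ R₁ R₂ R₃ Z} t → Barycentre l₁ l₂ l₃ R₁ R₂ R₃ Z →
  Barycentre l₁ l₂ l₃ (t ⊕ R₁) (t ⊕ R₂) (t ⊕ R₃) (t ⊕ Z)
Barycentre-translate {l₁} {l₂} {l₃} {x₁ , y₁} {x₂ , y₂} {x₃ , y₃} {z₁ , z₂} (a , b) (barycentre eq) =
  barycentre (cong₂ _,_ (shift a x₁ x₂ x₃ z₁ (cong proj₁ eq)) (shift b y₁ y₂ y₃ z₂ (cong proj₂ eq)))
  where
  open ≡-Reasoning
  shift : ∀ t x₁ x₂ x₃ z → (l₁ + l₂ + l₃) * z ≡ l₁ * x₁ + l₂ * x₂ + l₃ * x₃ →
          (l₁ + l₂ + l₃) * (t + z) ≡ l₁ * (t + x₁) + l₂ * (t + x₂) + l₃ * (t + x₃)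
  shift t x₁ x₂ x₃ z h = begin
    (l₁ + l₂ + l₃) * (t + z)                          ≡⟨ ℤP.*-distribˡ-+ (l₁ + l₂ + l₃) t z ⟩
    (l₁ + l₂ + l₃) * t + (l₁ + l₂ + l₃) * z           ≡⟨ cong (λ s → (l₁ + l₂ + l₃) * t + s) h ⟩
    (l₁ + l₂ + l₃) * t + (l₁ * x₁ + l₂ * x₂ + l₃ * x₃) ≡⟨ regroup l₁ l₂ l₃ t x₁ x₂ x₃ ⟩
    l₁ * (t + x₁) + l₂ * (t + x₂) + l₃ * (t + x₃)     ∎
    where
    regroup : ∀ l₁ l₂ l₃ t x₁ x₂ x₃ → (l₁ + l₂ + l₃) * t + (l₁ * x₁ + l₂ * x₂ + l₃ * x₃) ≡
              l₁ * (t + x₁) + l₂ * (t + x₂) + l₃ * (t + x₃)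
    regroup = solve-∀

IsConvex-translate : ∀ {Y} → IsConvex Y → ∀ t → IsConvex (λ R → Y (t ⊕ R))
IsConvex-translate convex t l₁ l₂ l₃ p₁ p₂ p₃ p eq =
  convex l₁ l₂ l₃ p₁ p₂ p₃ p (Barycentre-translate t eq)

IsConvex-linear : ∀ {Y} → IsConvex Y → ∀ r₁ r₂ → IsConvex (λ R → Y (linear r₁ r₂ R))
IsConvex-linear convex r₁ r₂ l₁ l₂ l₃ p₁ p₂ p₃ p eq =
  convex l₁ l₂ l₃ p₁ p₂ p₃ p (barycentre (cong₂ _,_ (Barycentre-· r₁ eq) (Barycentre-· r₂ eq)))

Υ-point : ℤ → Pt → Set
Υ-point d (x , y) = (x , y) ≡ origin ⊎ (1ℤ ≤ x × 1ℤ ≤ y × x + y ≤ d + 1ℤ)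

module ConvexWithOrigin {Y : PtSet} (convex : IsConvex Y) (Y₀ : Y origin) where

  triangle : ∀ {A B T} l₁ l₂ k → 0ℤ ≤ l₁ → 0ℤ ≤ l₂ → l₁ + l₂ ≤ k → 0ℤ < k →
             k ⊛ T ≡ l₁ ⊛ A ⊕ l₂ ⊛ B → Y A → Y B → Y T
  triangle {A} {B} {T} l₁ l₂ k 0≤l₁ 0≤l₂ l₁+l₂≤k 0<k eq yA yB =
    convex l₁ l₂ l₃ 0≤l₁ 0≤l₂ (0≤j-i l₁+l₂≤k) (subst (0ℤ <_) (sym l₁+l₂+l₃≡k) 0<k)
      (barycentre (trans (cong (_⊛ T) l₁+l₂+l₃≡k) (trans eq (sym (⊕-⊛origin _ l₃))))) yA yB Y₀
    where
    l₃ = k - (l₁ + l₂)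
    l₁+l₂+l₃≡k : l₁ + l₂ + l₃ ≡ k
    l₁+l₂+l₃≡k = cancel l₁ l₂ k
      where
      cancel : ∀ l₁ l₂ k → l₁ + l₂ + (k - (l₁ + l₂)) ≡ k
      cancel = solve-∀

  ray : ∀ {k T} → 1ℤ ≤ k → Y (k ⊛ T) → Y T
  ray {k} {x , y} 1≤k y-kT = triangle 1ℤ 0ℤ k (+≤+ z≤n) ℤP.≤-refl 1≤k (1≤⇒0< 1≤k)
    (cong₂ _,_ (unit (k * x)) (unit (k * y))) y-kT y-kT
    where
    unit : ∀ a → a ≡ 1ℤ * a + 0ℤ * a
    unit a = sym (trans (ℤP.+-identityʳ (1ℤ * a)) (ℤP.*-identityˡ a))

  -- The segment between the two points crosses the x-axis at abscissa ≥ 1.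
  straddle : ∀ {a₁ a₂ b₁ b₂} → 1ℤ ≤ a₁ → 1ℤ ≤ a₂ → 1ℤ ≤ b₁ → b₂ ≤ 0ℤ →
             Y (a₁ , a₂) → Y (b₁ , b₂) → Y (1ℤ , 0ℤ)
  straddle {a₁} {a₂} {b₁} {b₂} 1≤a₁ 1≤a₂ 1≤b₁ b₂≤0 =
    triangle (- b₂) a₂ k 0≤-b₂ (1≤⇒0≤ 1≤a₂) (≤-byDifference _ (slack a₁ a₂ b₁ b₂) 0≤slack)
      (1≤⇒0< (≤-byDifference _ (excess a₁ a₂ b₁ b₂) (0≤i+j (0≤i+j 0≤slack 0≤-b₂) (0≤j-i 1≤a₂))))
      (cong₂ _,_ (first a₁ a₂ b₁ b₂) (second a₁ a₂ b₁ b₂))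
    where
    k = a₂ * b₁ - b₂ * a₁
    0≤-b₂ : 0ℤ ≤ - b₂
    0≤-b₂ = ℤP.neg-mono-≤ b₂≤0
    0≤slack : 0ℤ ≤ a₂ * (b₁ - 1ℤ) + (- b₂) * (a₁ - 1ℤ)
    0≤slack = 0≤i+j (0≤i*j (1≤⇒0≤ 1≤a₂) (0≤j-i 1≤b₁)) (0≤i*j 0≤-b₂ (0≤j-i 1≤a₁))
    slack : ∀ a₁ a₂ b₁ b₂ → (a₂ * b₁ - b₂ * a₁) - (- b₂ + a₂) ≡ a₂ * (b₁ - 1ℤ) + (- b₂) * (a₁ - 1ℤ)
    slack = solve-∀
    excess : ∀ a₁ a₂ b₁ b₂ → (a₂ * b₁ - b₂ * a₁) - 1ℤ ≡ a₂ * (b₁ - 1ℤ) + (- b₂) * (a₁ - 1ℤ) + (- b₂) + (a₂ - 1ℤ)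
    excess = solve-∀
    first : ∀ a₁ a₂ b₁ b₂ → (a₂ * b₁ - b₂ * a₁) * 1ℤ ≡ (- b₂) * a₁ + a₂ * b₁
    first = solve-∀
    second : ∀ a₁ a₂ b₁ b₂ → (a₂ * b₁ - b₂ * a₁) * 0ℤ ≡ (- b₂) * a₂ + a₂ * b₂
    second = solve-∀

  Υ-fill : ∀ {d} → 1ℤ ≤ d → Y (d , 1ℤ) → Y (1ℤ , d) → ∀ T → Υ-point d T → Y T
  Υ-fill _ _ _ _ (inj₁ refl) = Y₀
  Υ-fill {d} 1≤d y-d1 y-1d (x , y) (inj₂ (1≤x , 1≤y , x+y≤d+1)) with d ℤ.≤? 1ℤ
  ... | yes d≤1 = subst Y (sym (cong₂ _,_ x≡d y≡1)) y-d1
    where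
    room : 0ℤ ≤ d + 1ℤ - (x + y)
    room = 0≤j-i x+y≤d+1
    x≡d : x ≡ d
    x≡d = ℤP.≤-antisym (≤-byDifference _ (gap₁ d x y) (0≤i+j room (0≤j-i 1≤y))) (ℤP.≤-trans d≤1 1≤x)
      where
      gap₁ : ∀ d x y → d - x ≡ d + 1ℤ - (x + y) + (y - 1ℤ)
      gap₁ = solve-∀
    y≡1 : y ≡ 1ℤ
    y≡1 = ℤP.≤-antisym (ℤP.≤-trans (≤-byDifference _ (gap₂ d x y) (0≤i+j room (0≤j-i 1≤x))) d≤1) 1≤y
      where
      gap₂ : ∀ d x y → d - y ≡ d + 1ℤ - (x + y) + (x - 1ℤ)
      gap₂ = solve-∀
  ... | no d≰1 =
    triangle (d * x - y) (d * y - x) (d * d - 1ℤ) 0≤dx-y 0≤dy-x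
      (≤-byDifference _ (slack d x y) (0≤i*j (0≤j-i 1≤d) room))
      (1≤⇒0< (≤-byDifference _ (excess d) (0≤i+j (0≤i+j (0≤i*j (0≤j-i 2≤d) (0≤j-i 2≤d)) (0≤i*j {+ 4} (+≤+ z≤n) (0≤j-i 2≤d))) (+≤+ z≤n))))
      (cong₂ _,_ (first d x y) (second d x y)) y-d1 y-1d
    where
    2≤d : + 2 ≤ d
    2≤d = ℤP.i<j⇒suc[i]≤j (ℤP.≰⇒> d≰1)
    room : 0ℤ ≤ d + 1ℤ - (x + y)
    room = 0≤j-i x+y≤d+1
    0≤dx-y : 0ℤ ≤ d * x - y
    0≤dx-y = subst (0ℤ ≤_) (sym (split₁ d x y)) (0≤i+j (0≤i+j (0≤i*j (1≤⇒0≤ 1≤d) (0≤j-i 1≤x)) room) (0≤j-i 1≤x))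
      where
      split₁ : ∀ d x y → d * x - y ≡ d * (x - 1ℤ) + (d + 1ℤ - (x + y)) + (x - 1ℤ)
      split₁ = solve-∀
    0≤dy-x : 0ℤ ≤ d * y - x
    0≤dy-x = subst (0ℤ ≤_) (sym (split₂ d x y)) (0≤i+j (0≤i+j (0≤i*j (1≤⇒0≤ 1≤d) (0≤j-i 1≤y)) room) (0≤j-i 1≤y))
      where
      split₂ : ∀ d x y → d * y - x ≡ d * (y - 1ℤ) + (d + 1ℤ - (x + y)) + (y - 1ℤ)
      split₂ = solve-∀
    slack : ∀ d x y → (d * d - 1ℤ) - ((d * x - y) + (d * y - x)) ≡ (d - 1ℤ) * (d + 1ℤ - (x + y))
    slack = solve-∀
    excess : ∀ d → (d * d - 1ℤ) - 1ℤ ≡ (d - + 2) * (d - + 2) + + 4 * (d - + 2) + + 2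
    excess = solve-∀
    first : ∀ d x y → (d * d - 1ℤ) * x ≡ (d * x - y) * d + (d * y - x) * 1ℤ
    first = solve-∀
    second : ∀ d x y → (d * d - 1ℤ) * y ≡ (d * x - y) * 1ℤ + (d * y - x) * d
    second = solve-∀


-- Lattice points of Υ

Upsilon-≤ : ∀ {d} u C → origin · u ≤ C → (1ℤ , d) · u ≤ C → (d , 1ℤ) · u ≤ C →
            ∀ {T} → LatPts (Upsilon d) T → T · u ≤ C
Upsilon-≤ u C h₀ h₁ h₂ = InConv-≤ u C λ
  { _ (here refl) → h₀ ; _ (there (here refl)) → h₁ ; _ (there (there (here refl))) → h₂ }

private
  vanish : ∀ {d x y} → 0ℤ ≤ d → y ≤ d * x → 0ℤ ≤ x + y → x ≤ 0ℤ → x ≡ 0ℤ × y ≡ 0ℤ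
  vanish {d} {x} {y} 0≤d y≤dx 0≤x+y x≤0 = ℤP.≤-antisym x≤0 0≤x , ℤP.≤-antisym y≤0 0≤y
    where
    y≤0 : y ≤ 0ℤ
    y≤0 = ℤP.≤-trans y≤dx (≤-byDifference _ (negate d x) (0≤i*j 0≤d (0≤j-i x≤0)))
      where
      negate : ∀ d x → 0ℤ - d * x ≡ d * (0ℤ - x)
      negate = solve-∀
    0≤x : 0ℤ ≤ x
    0≤x = ≤-byDifference _ (split x y) (0≤i+j 0≤x+y (0≤j-i y≤0))
      where
      split : ∀ x y → x - 0ℤ ≡ x + y + (0ℤ - y)
      split = solve-∀
    0≤y : 0ℤ ≤ y
    0≤y = ≤-byDifference _ (split y x) (0≤i+j 0≤x+y (0≤j-i x≤0))
      where
      split : ∀ y x → y - 0ℤ ≡ x + y + (0ℤ - x)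
      split = solve-∀

Υ-point-fromInequalities : ∀ {d x y} → 0ℤ ≤ d → y ≤ d * x → x ≤ d * y → 0ℤ ≤ x + y → x + y ≤ d + 1ℤ →
                           Υ-point d (x , y)
Υ-point-fromInequalities {d} {x} {y} 0≤d y≤dx x≤dy 0≤x+y x+y≤d+1 with 1ℤ ℤ.≤? x | 1ℤ ℤ.≤? y
... | yes 1≤x | yes 1≤y = inj₂ (1≤x , 1≤y , x+y≤d+1)
... | no x≱1 | _ = inj₁ (cong₂ _,_ x≡0 y≡0)
  where
  x≤0 = ℤP.i<j⇒i≤pred[j] (ℤP.≰⇒> x≱1)
  x≡0 = proj₁ (vanish 0≤d y≤dx 0≤x+y x≤0)
  y≡0 = proj₂ (vanish 0≤d y≤dx 0≤x+y x≤0)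
... | _ | no y≱1 = inj₁ (cong₂ _,_ x≡0 y≡0)
  where
  y≤0 = ℤP.i<j⇒i≤pred[j] (ℤP.≰⇒> y≱1)
  0≤y+x = subst (0ℤ ≤_) (ℤP.+-comm x y) 0≤x+y
  x≡0 = proj₂ (vanish 0≤d x≤dy 0≤y+x y≤0)
  y≡0 = proj₁ (vanish 0≤d x≤dy 0≤y+x y≤0)

Upsilon⇒Υ-point : ∀ {d} → 1ℤ ≤ d → ∀ T → LatPts (Upsilon d) T → Υ-point d T
Upsilon⇒Υ-point {d} 1≤d (x , y) hT = Υ-point-fromInequalities 0≤d y≤dx x≤dy 0≤x+y x+y≤d+1
  where
  0≤d = 1≤⇒0≤ 1≤d
  0≤d²-1 : 0ℤ ≤ (d - 1ℤ) * (d - 1ℤ) + + 2 * (d - 1ℤ)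
  0≤d²-1 = 0≤i+j (0≤i*j (0≤j-i 1≤d) (0≤j-i 1≤d)) (0≤i*j {+ 2} (+≤+ z≤n) (0≤j-i 1≤d))
  y≤dx : y ≤ d * x
  y≤dx = ≤-byDifference _ (flip d x y) (0≤j-i (Upsilon-≤ (- d , 1ℤ) 0ℤ ℤP.≤-refl
           (ℤP.≤-reflexive (at-1d d)) (≤-byDifference _ (at-d1 d) 0≤d²-1) hT))
    where
    flip : ∀ d x y → d * x - y ≡ 0ℤ - (x * - d + y * 1ℤ)
    flip = solve-∀
    at-1d : ∀ d → 1ℤ * - d + d * 1ℤ ≡ 0ℤ
    at-1d = solve-∀
    at-d1 : ∀ d → 0ℤ - (d * - d + 1ℤ * 1ℤ) ≡ (d - 1ℤ) * (d - 1ℤ) + + 2 * (d - 1ℤ)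
    at-d1 = solve-∀
  x≤dy : x ≤ d * y
  x≤dy = ≤-byDifference _ (flip d x y) (0≤j-i (Upsilon-≤ (1ℤ , - d) 0ℤ ℤP.≤-refl
           (≤-byDifference _ (at-1d d) 0≤d²-1) (ℤP.≤-reflexive (at-d1 d)) hT))
    where
    flip : ∀ d x y → d * y - x ≡ 0ℤ - (x * 1ℤ + y * - d)
    flip = solve-∀
    at-1d : ∀ d → 0ℤ - (1ℤ * 1ℤ + d * - d) ≡ (d - 1ℤ) * (d - 1ℤ) + + 2 * (d - 1ℤ)
    at-1d = solve-∀
    at-d1 : ∀ d → d * 1ℤ + 1ℤ * - d ≡ 0ℤ
    at-d1 = solve-∀
  0≤x+y : 0ℤ ≤ x + y
  0≤x+y = ≤-byDifference _ (flip x y) (0≤j-i (Upsilon-≤ (-1ℤ , -1ℤ) 0ℤ ℤP.≤-refl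
            (≤-byDifference _ (at-1d d) (0≤i+j 0≤d (+≤+ z≤n))) (≤-byDifference _ (at-d1 d) (0≤i+j 0≤d (+≤+ z≤n))) hT))
    where
    flip : ∀ x y → x + y - 0ℤ ≡ 0ℤ - (x * -1ℤ + y * -1ℤ)
    flip = solve-∀
    at-1d : ∀ d → 0ℤ - (1ℤ * -1ℤ + d * -1ℤ) ≡ d + 1ℤ
    at-1d = solve-∀
    at-d1 : ∀ d → 0ℤ - (d * -1ℤ + 1ℤ * -1ℤ) ≡ d + 1ℤ
    at-d1 = solve-∀
  x+y≤d+1 : x + y ≤ d + 1ℤ
  x+y≤d+1 = subst (_≤ d + 1ℤ) (sum x y) (Upsilon-≤ (1ℤ , 1ℤ) (d + 1ℤ) (0≤i+j 0≤d (+≤+ z≤n))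
              (ℤP.≤-reflexive (at-1d d)) (ℤP.≤-reflexive (sum d 1ℤ)) hT)
    where
    sum : ∀ x y → x * 1ℤ + y * 1ℤ ≡ x + y
    sum = solve-∀
    at-1d : ∀ d → 1ℤ * 1ℤ + d * 1ℤ ≡ d + 1ℤ
    at-1d = solve-∀

LatPts-Upsilon⇔ : ∀ {d} → 1ℤ ≤ d → ∀ T → LatPts (Upsilon d) T ⇔ Υ-point d T
LatPts-Upsilon⇔ 1≤d T = mk⇔ (Upsilon⇒Υ-point 1≤d T)
  (ConvexWithOrigin.Υ-fill (InConv-convex _) (⊆-InConv (here refl)) 1≤d
    (⊆-InConv (there (there (here refl)))) (⊆-InConv (there (here refl))) T)


-- Primitive vectors and unimodular bases

Bézout⇒Primitive : ∀ {a b} s t → ∣ s * a + t * b ∣ ≡ 1 → Primitive (a , b)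
Bézout⇒Primitive {a} {b} s t eq = cong +_ (ℕDiv.∣1⇒≡1 (subst (ℕDiv._∣_ ∣ gcd a b ∣) eq gcd∣combination))
  where
  gcd∣combination : ∣ gcd a b ∣ ℕDiv.∣ ∣ s * a + t * b ∣
  gcd∣combination = DS.∣⇒∣ᵤ (DS.∣m∣n⇒∣m+n (DS.∣n⇒∣m*n s (DS.∣ᵤ⇒∣ {gcd a b} {a} (gcd[i,j]∣i a b)))
                                            (DS.∣n⇒∣m*n t (DS.∣ᵤ⇒∣ {gcd a b} {b} (gcd[i,j]∣j a b))))

private
  sign-of : ∀ i → Σ ℤ λ σ → σ * i ≡ + ∣ i ∣
  sign-of (+ n) = 1ℤ , ℤP.*-identityˡ (+ n)
  sign-of -[1+ n ] = -1ℤ , ℤP.-1*i≡-i -[1+ n ]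

  lift-Bézout : ∀ x y m n → 1 ℕ.+ y ℕ.* n ≡ x ℕ.* m → + x * + m - + y * + n ≡ 1ℤ
  lift-Bézout x y m n eq = begin
    + x * + m - + y * + n             ≡⟨ cong₂ _-_ (sym (ℤP.pos-* x m)) (sym (ℤP.pos-* y n)) ⟩
    + (x ℕ.* m) - + (y ℕ.* n)         ≡⟨ cong (λ k → + k - + (y ℕ.* n)) (sym eq) ⟩
    + (1 ℕ.+ y ℕ.* n) - + (y ℕ.* n)   ≡⟨ cong (_- + (y ℕ.* n)) (ℤP.pos-+ 1 (y ℕ.* n)) ⟩
    1ℤ + + (y ℕ.* n) - + (y ℕ.* n)    ≡⟨ cancel (+ (y ℕ.* n)) ⟩
    1ℤ                                ∎
    where
    open ≡-Reasoning
    cancel : ∀ k → 1ℤ + k - k ≡ 1ℤ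
    cancel = solve-∀

  signed-Bézout : ∀ {a b} x y σ τ → σ * a ≡ + ∣ a ∣ → τ * b ≡ + ∣ b ∣ → + x * + ∣ a ∣ - + y * + ∣ b ∣ ≡ 1ℤ →
                  (+ x * σ) * a + (- (+ y * τ)) * b ≡ 1ℤ
  signed-Bézout {a} {b} x y σ τ σa τb eq =
    trans (regroup (+ x) (+ y) σ τ a b) (trans (cong₂ (λ p q → + x * p - + y * q) σa τb) eq)
    where
    regroup : ∀ x y σ τ a b → (x * σ) * a + (- (y * τ)) * b ≡ x * (σ * a) - y * (τ * b)
    regroup = solve-∀

Primitive⇒Bézout : ∀ {a b} → Primitive (a , b) → Σ ℤ λ s → Σ ℤ λ t → s * a + t * b ≡ 1ℤ
Primitive⇒Bézout {a} {b} prim with sign-of a | sign-of b | coprime-Bézout (gcd≡1⇒coprime {∣ a ∣} {∣ b ∣} (ℤP.+-injective prim))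
... | σ , σa | τ , τb | Bézout.+- x y eq = + x * σ , - (+ y * τ) , signed-Bézout x y σ τ σa τb (lift-Bézout x y ∣ a ∣ ∣ b ∣ eq)
... | σ , σa | τ , τb | Bézout.-+ x y eq =
  - (+ x * σ) , + y * τ , trans (ℤP.+-comm (- (+ x * σ) * a) _) (signed-Bézout y x τ σ τb σa (lift-Bézout y x ∣ b ∣ ∣ a ∣ eq))

Primitive-neg : ∀ {v} → Primitive v → Primitive (neg v)
Primitive-neg {a , b} prim = trans (cong₂ (λ m n → + ℕGCD.gcd m n) (ℤP.∣-i∣≡∣i∣ a) (ℤP.∣-i∣≡∣i∣ b)) prim

det : Pt → Pt → ℤ
det (a , b) (c , e) = a * e - b * c

Unimodular : ℤ → Set
Unimodular δ = δ ≡ 1ℤ ⊎ δ ≡ -1ℤ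

Unimodular-neg : ∀ {δ} → Unimodular δ → Unimodular (- δ)
Unimodular-neg (inj₁ refl) = inj₂ refl
Unimodular-neg (inj₂ refl) = inj₁ refl

Unimodular-square : ∀ {δ} → Unimodular δ → δ * δ ≡ 1ℤ
Unimodular-square (inj₁ refl) = refl
Unimodular-square (inj₂ refl) = refl

Unimodular-abs : ∀ {δ} → Unimodular δ → ∣ δ ∣ ≡ 1
Unimodular-abs (inj₁ refl) = refl
Unimodular-abs (inj₂ refl) = refl

-- The rows of a unimodular matrix, used as the coordinate functionals of a lattice basis.
record Basis : Set where
  constructor mkBasis
  field
    u₁ u₂ : Pt
    unimodular : Unimodular (det u₁ u₂)

open Basis

coords : Basis → Pt → Pt
coords B = linear (u₁ B) (u₂ B)

-- The inverse of a unimodular matrix is δ · adj with δ = det = det⁻¹.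
coords⁻¹ : Basis → Pt → Pt
coords⁻¹ (mkBasis (a , b) (c , e) _) = linear (δ ⊛ (e , - b)) (δ ⊛ (- c , a))
  where δ = a * e - b * c

private
  cancel-δ² : ∀ {δ} → Unimodular δ → ∀ x → δ * δ * x ≡ x
  cancel-δ² uni x = trans (cong (_* x) (Unimodular-square uni)) (ℤP.*-identityˡ x)

coords-coords⁻¹ : ∀ B T → coords B (coords⁻¹ B T) ≡ T
coords-coords⁻¹ (mkBasis (a , b) (c , e) uni) (α , β) =
  cong₂ _,_ (trans (inv₁ (a * e - b * c) a b c e α β) (cancel-δ² uni α))
            (trans (inv₂ (a * e - b * c) a b c e α β) (cancel-δ² uni β))
  where
  inv₁ : ∀ δ a b c e α β → (α * (δ * e) + β * (δ * - b)) * a + (α * (δ * - c) + β * (δ * a)) * b ≡ δ * (a * e - b * c) * α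
  inv₁ = solve-∀
  inv₂ : ∀ δ a b c e α β → (α * (δ * e) + β * (δ * - b)) * c + (α * (δ * - c) + β * (δ * a)) * e ≡ δ * (a * e - b * c) * β
  inv₂ = solve-∀

coords⁻¹-coords : ∀ B R → coords⁻¹ B (coords B R) ≡ R
coords⁻¹-coords (mkBasis (a , b) (c , e) uni) (x , y) =
  cong₂ _,_ (trans (inv₁ (a * e - b * c) a b c e x y) (cancel-δ² uni x))
            (trans (inv₂ (a * e - b * c) a b c e x y) (cancel-δ² uni y))
  where
  inv₁ : ∀ δ a b c e x y → (x * a + y * b) * (δ * e) + (x * c + y * e) * (δ * - b) ≡ δ * (a * e - b * c) * x
  inv₁ = solve-∀
  inv₂ : ∀ δ a b c e x y → (x * a + y * b) * (δ * - c) + (x * c + y * e) * (δ * a) ≡ δ * (a * e - b * c) * y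
  inv₂ = solve-∀

swap : Basis → Basis
swap B = mkBasis (u₂ B) (u₁ B) (subst Unimodular (sym (antisymmetric (u₁ B) (u₂ B))) (Unimodular-neg (unimodular B)))
  where
  antisymmetric : ∀ u v → det v u ≡ - det u v
  antisymmetric (a , b) (c , e) = flip a b c e
    where
    flip : ∀ a b c e → c * b - e * a ≡ - (a * e - b * c)
    flip = solve-∀

shear : Basis → Basis
shear B = mkBasis (u₁ B) (u₂ B ⊖ u₁ B) (subst Unimodular (sym (invariant (u₁ B) (u₂ B))) (unimodular B))
  where
  invariant : ∀ u v → det u (v ⊖ u) ≡ det u v
  invariant (a , b) (c , e) = cancel a b c e
    where
    cancel : ∀ a b c e → a * (e - b) - b * (c - a) ≡ a * e - b * c
    cancel = solve-∀

u₁-primitive : ∀ B → Primitive (u₁ B)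
u₁-primitive (mkBasis (a , b) (c , e) uni) = Bézout⇒Primitive e (- c) (trans (cong ∣_∣ (expand a b c e)) (Unimodular-abs uni))
  where
  expand : ∀ a b c e → e * a + (- c) * b ≡ a * e - b * c
  expand = solve-∀

unimodular-complement : ∀ ℓ → Primitive ℓ → Σ Pt λ m → Unimodular (det m ℓ)
unimodular-complement (ℓ₁ , ℓ₂) prim with Primitive⇒Bézout prim
... | s , t , eq = (t , - s) , inj₁ (trans (expand s t ℓ₁ ℓ₂) eq)
  where
  expand : ∀ s t ℓ₁ ℓ₂ → t * ℓ₂ - (- s) * ℓ₁ ≡ s * ℓ₁ + t * ℓ₂
  expand = solve-∀


-- Convex sets in a level strip

LevelStrip : PtSet → Pt → ℤ → ℤ → Set
LevelStrip Y ℓ L w = ∀ R → Y R → R ≢ origin → L ≤ R · ℓ × R · ℓ ≤ L + w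

WideFromOrigin : PtSet → ℤ → Set
WideFromOrigin Y d = ∀ u → Primitive u → (∀ R → Y R → 0ℤ ≤ R · u) → Σ Pt λ R → Y R × d ≤ R · u

module Strip (Y : PtSet) (Y-convex : IsConvex Y) (Y₀ : Y origin)
             (ℓ : Pt) (ℓ-primitive : Primitive ℓ) (L w : ℤ) (2≤L : + 2 ≤ L)
             (level : LevelStrip Y ℓ L w)
             (R₁ : Pt) (Y-R₁ : Y R₁) (R₁≢0 : R₁ ≢ origin) where

  Y[_] : Basis → PtSet
  Y[ B ] T = Y (coords⁻¹ B T)

  Y[]-convex : ∀ B → IsConvex Y[ B ]
  Y[]-convex (mkBasis (a , b) (c , e) _) = IsConvex-linear Y-convex _ _

  Y[]-origin : ∀ B → Y[ B ] origin
  Y[]-origin (mkBasis (a , b) (c , e) _) = Y₀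

  Y⇒Y[] : ∀ B {R} → Y R → Y[ B ] (coords B R)
  Y⇒Y[] B {R} = subst Y (sym (coords⁻¹-coords B R))

  Weights : Basis → ℤ → ℤ → Set
  Weights B b c = b ⊛ u₁ B ⊕ c ⊛ u₂ B ≡ ℓ

  level-coords : ∀ B b c → Weights B b c → ∀ R → R · ℓ ≡ b * (R · u₁ B) + c * (R · u₂ B)
  level-coords B b c weights R = begin
    R · ℓ                                   ≡⟨ cong (R ·_) (sym weights) ⟩
    R · (b ⊛ u₁ B ⊕ c ⊛ u₂ B)               ≡⟨ ·-⊕ʳ R (b ⊛ u₁ B) (c ⊛ u₂ B) ⟩
    R · (b ⊛ u₁ B) + R · (c ⊛ u₂ B)         ≡⟨ cong₂ _+_ (·-⊛ʳ R b (u₁ B)) (·-⊛ʳ R c (u₂ B)) ⟩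
    b * (R · u₁ B) + c * (R · u₂ B)         ∎
    where open ≡-Reasoning

  absent-below-L : ∀ B b c → Weights B b c → ∀ {x y} → b * x + c * y < L → (x , y) ≢ origin → ¬ Y[ B ] (x , y)
  absent-below-L B b c weights {x} {y} low nonzero inY =
    ℤP.<-irrefl refl (ℤP.≤-<-trans (proj₁ (level R inY R≢0)) (subst (_< L) (sym R-level) low))
    where
    R = coords⁻¹ B (x , y)
    R≢0 : R ≢ origin
    R≢0 R≡0 = nonzero (trans (sym (coords-coords⁻¹ B (x , y)))
                             (trans (cong (coords B) R≡0) (cong₂ _,_ (origin-· (u₁ B)) (origin-· (u₂ B)))))
    R-level : R · ℓ ≡ b * x + c * y
    R-level = trans (level-coords B b c weights R) (cong (λ T → b * proj₁ T + c * proj₂ T) (coords-coords⁻¹ B (x , y)))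

  level≰0 : ∀ R → Y R → R ≢ origin → ¬ (R · ℓ ≤ 0ℤ)
  level≰0 R yR R≢0 R·ℓ≤0 =
    ℤP.<-irrefl refl (ℤP.≤-<-trans (ℤP.≤-trans (proj₁ (level R yR R≢0)) R·ℓ≤0) (ℤP.<-≤-trans (ℤ.+<+ (s≤s z≤n)) 2≤L))

  -- Points of Y strictly above and on or below the x-axis would put (1,0), of level b, into Y.
  second-coordinate-positive : ∀ B b c → 0ℤ ≤ b → 0ℤ ≤ c → b < L → Weights B b c →
                               1ℤ ≤ R₁ · u₁ B → 1ℤ ≤ R₁ · u₂ B → ∀ R → Y R → R ≢ origin → 1ℤ ≤ R · u₂ B
  second-coordinate-positive B b c 0≤b 0≤c b<L weights 1≤α₁ 1≤β₁ R yR R≢0 = ≰0⇒1≤ λ β≤0 →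
    absent-below-L B b c weights (subst (_< L) (sym (unit-x b c)) b<L) (λ ())
      (ConvexWithOrigin.straddle (Y[]-convex B) (Y[]-origin B) 1≤α₁ 1≤β₁ (1≤α β≤0) β≤0 (Y⇒Y[] B Y-R₁) (Y⇒Y[] B yR))
    where
    unit-x : ∀ b c → b * 1ℤ + c * 0ℤ ≡ b
    unit-x = solve-∀
    1≤α : R · u₂ B ≤ 0ℤ → 1ℤ ≤ R · u₁ B
    1≤α β≤0 = ≰0⇒1≤ λ α≤0 → level≰0 R yR R≢0
      (≤-byDifference _ (trans (cong (_-_ 0ℤ) (level-coords B b c weights R)) (negate b c (R · u₁ B) (R · u₂ B)))
        (0≤i+j (0≤i*j 0≤b (0≤j-i α≤0)) (0≤i*j 0≤c (0≤j-i β≤0))))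
      where
      negate : ∀ b c α β → 0ℤ - (b * α + c * β) ≡ b * (0ℤ - α) + c * (0ℤ - β)
      negate = solve-∀

  Weights-swap : ∀ B b c → Weights B b c → Weights (swap B) c b
  Weights-swap B b c weights = trans (⊕-comm (c ⊛ u₂ B) (b ⊛ u₁ B)) weights

  record Frame : Set where
    constructor frame
    field
      basis    : Basis
      b c      : ℤ
      1≤b      : 1ℤ ≤ b
      1≤c      : 1ℤ ≤ c
      weights  : Weights basis b c
      positive : ∀ R → Y R → R ≢ origin → 1ℤ ≤ R · u₁ basis × 1ℤ ≤ R · u₂ basis

    weight : ℤ
    weight = b + c

  open Frame using (basis; weight)

  frame-through-R₁ : ∀ B b c → 1ℤ ≤ b → 1ℤ ≤ c → b < L → c < L → Weights B b c →
                     1ℤ ≤ R₁ · u₁ B → 1ℤ ≤ R₁ · u₂ B → Frame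
  frame-through-R₁ B b c 1≤b 1≤c b<L c<L weights 1≤α₁ 1≤β₁ = frame B b c 1≤b 1≤c weights λ R yR R≢0 →
    second-coordinate-positive (swap B) c b (1≤⇒0≤ 1≤c) (1≤⇒0≤ 1≤b) c<L (Weights-swap B b c weights) 1≤β₁ 1≤α₁ R yR R≢0 ,
    second-coordinate-positive B b c (1≤⇒0≤ 1≤b) (1≤⇒0≤ 1≤c) b<L weights 1≤α₁ 1≤β₁ R yR R≢0

  swap-frame : Frame → Frame
  swap-frame F = frame (swap B) c b 1≤c 1≤b (Weights-swap B b c weights) (λ R yR R≢0 → Product.swap (positive R yR R≢0))
    where open Frame F renaming (basis to B)

  -- In sheared coordinates (x, y - x) the former point (1,1) becomes (1,0), still of level b + c < L.
  shear-frame : (F : Frame) → weight F < L → R₁ · u₁ (basis F) < R₁ · u₂ (basis F) →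
                Σ Frame λ F′ → weight F < weight F′
  shear-frame (frame B b c 1≤b 1≤c weights positive) b+c<L α₁<β₁ =
    frame-through-R₁ (shear B) (b + c) c (ℤP.≤-trans 1≤b (i≤i+j b (1≤⇒0≤ 1≤c))) 1≤c b+c<L c<L weights′
      (proj₁ (positive R₁ Y-R₁ R₁≢0)) (subst (1ℤ ≤_) (sym (·-⊖ʳ R₁ (u₂ B) (u₁ B))) (i<j⇒1≤j-i α₁<β₁)) ,
    i<i+j (b + c) 1≤c
    where
    c<L : c < L
    c<L = ℤP.≤-<-trans (subst (c ≤_) (ℤP.+-comm c b) (i≤i+j c (1≤⇒0≤ 1≤b))) b+c<L
    weights′ : Weights (shear B) (b + c) c
    weights′ = trans (cong₂ _,_ (regroup b c (proj₁ (u₁ B)) (proj₁ (u₂ B))) (regroup b c (proj₂ (u₁ B)) (proj₂ (u₂ B)))) weights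
      where
      regroup : ∀ b c x y → (b + c) * x + c * (y - x) ≡ b * x + c * y
      regroup = solve-∀

  diagonal-excluded : (F : Frame) → weight F < L → R₁ · u₁ (basis F) ≢ R₁ · u₂ (basis F)
  diagonal-excluded (frame B b c _ _ weights positive) b+c<L α₁≡β₁ =
    absent-below-L B b c weights (subst (_< L) (sym (unit-xy b c)) b+c<L) (λ ())
      (ConvexWithOrigin.ray (Y[]-convex B) (Y[]-origin B) {T = 1ℤ , 1ℤ} (proj₁ (positive R₁ Y-R₁ R₁≢0))
        (subst Y[ B ] (cong₂ _,_ (sym (ℤP.*-identityʳ α₁)) (trans (sym α₁≡β₁) (sym (ℤP.*-identityʳ α₁)))) (Y⇒Y[] B Y-R₁)))
    where
    α₁ = R₁ · u₁ B
    unit-xy : ∀ b c → b * 1ℤ + c * 1ℤ ≡ b + c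
    unit-xy = solve-∀

  step : (F : Frame) → weight F < L → Σ Frame λ F′ → weight F < weight F′
  step F b+c<L with ℤP.<-cmp (R₁ · u₁ (basis F)) (R₁ · u₂ (basis F))
  ... | tri< α₁<β₁ _ _ = shear-frame F b+c<L α₁<β₁
  ... | tri≈ _ α₁≡β₁ _ = ⊥-elim (diagonal-excluded F b+c<L α₁≡β₁)
  ... | tri> _ _ β₁<α₁ = Product.map₂ (subst (_< _) (ℤP.+-comm (Frame.c F) (Frame.b F)))
                           (shear-frame (swap-frame F) (subst (_< L) (ℤP.+-comm (Frame.b F) (Frame.c F)) b+c<L) β₁<α₁)

  iterate : ∀ fuel (F : Frame) → L ≤ weight F + + fuel → Σ Frame λ F′ → L ≤ weight F′
  iterate zero F L≤ = F , subst (L ≤_) (ℤP.+-identityʳ _) L≤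
  iterate (suc fuel) F L≤ with L ℤ.≤? weight F
  ... | yes done = F , done
  ... | no low with step F (ℤP.≰⇒> low)
  ...   | F′ , progress = iterate fuel F′ (ℤP.≤-trans L≤ (≤-byDifference _ (shift (weight F) (weight F′) (+ fuel))
                                                          (0≤j-i (ℤP.i<j⇒suc[i]≤j progress))))
    where
    shift : ∀ a a′ n → a′ + n - (a + (1ℤ + n)) ≡ a′ - (1ℤ + a)
    shift = solve-∀

  1<L : 1ℤ < L
  1<L = ℤP.<-≤-trans (ℤ.+<+ (s≤s (s≤s z≤n))) 2≤L

  -- With m completing ℓ to a basis, write R₁ · m = r + j (R₁ · ℓ) with 0 ≤ r < R₁ · ℓ; the basis
  -- (m - j ℓ, (j + 1) ℓ - m) then gives R₁ the coordinates (r, R₁ · ℓ - r).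
  initial : Frame
  initial = frame-through-R₁ B 1ℤ 1ℤ ℤP.≤-refl ℤP.≤-refl 1<L 1<L weights
              (subst (1ℤ ≤_) (sym α₁≡r) 1≤r) (subst (1ℤ ≤_) (sym β₁≡D-r) (i<j⇒1≤j-i r<D))
    where
    m = proj₁ (unimodular-complement ℓ ℓ-primitive)
    D = R₁ · ℓ
    1≤D : 1ℤ ≤ D
    1≤D = ℤP.≤-trans (ℤP.≤-trans (+≤+ (s≤s z≤n)) 2≤L) (proj₁ (level R₁ Y-R₁ R₁≢0))
    instance
      D-nonZero : ℤ.NonZero D
      D-nonZero = ℤ.>-nonZero (1≤⇒0< 1≤D)
    j = (R₁ · m) ℤ./ D
    r = + ((R₁ · m) ℤ.% D)
    r<D : r < D
    r<D = subst (r <_) (ℤP.0≤i⇒+∣i∣≡i (1≤⇒0≤ 1≤D)) (ℤ.+<+ (DivMod.n%d<d (R₁ · m) D))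
    B = mkBasis (m ⊖ j ⊛ ℓ) ((j + 1ℤ) ⊛ ℓ ⊖ m)
          (subst Unimodular (sym (invariant m ℓ)) (proj₂ (unimodular-complement ℓ ℓ-primitive)))
      where
      invariant : ∀ m ℓ → det (m ⊖ j ⊛ ℓ) ((j + 1ℤ) ⊛ ℓ ⊖ m) ≡ det m ℓ
      invariant (m₁ , m₂) (ℓ₁ , ℓ₂) = cancel j m₁ m₂ ℓ₁ ℓ₂
        where
        cancel : ∀ j m₁ m₂ ℓ₁ ℓ₂ →
          (m₁ - j * ℓ₁) * ((j + 1ℤ) * ℓ₂ - m₂) - (m₂ - j * ℓ₂) * ((j + 1ℤ) * ℓ₁ - m₁) ≡ m₁ * ℓ₂ - m₂ * ℓ₁
        cancel = solve-∀
    weights : Weights B 1ℤ 1ℤ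
    weights = cong₂ _,_ (telescope j (proj₁ m) (proj₁ ℓ)) (telescope j (proj₂ m) (proj₂ ℓ))
      where
      telescope : ∀ j m ℓ → 1ℤ * (m - j * ℓ) + 1ℤ * ((j + 1ℤ) * ℓ - m) ≡ ℓ
      telescope = solve-∀
    α₁≡r : R₁ · u₁ B ≡ r
    α₁≡r = begin
      R₁ · (m ⊖ j ⊛ ℓ)           ≡⟨ ·-⊖ʳ R₁ m (j ⊛ ℓ) ⟩
      R₁ · m - R₁ · (j ⊛ ℓ)      ≡⟨ cong₂ _-_ (DivMod.a≡a%n+[a/n]*n (R₁ · m) D) (·-⊛ʳ R₁ j ℓ) ⟩
      r + j * D - j * D          ≡⟨ cancel r (j * D) ⟩
      r                          ∎
      where
      open ≡-Reasoning
      cancel : ∀ r s → r + s - s ≡ r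
      cancel = solve-∀
    β₁≡D-r : R₁ · u₂ B ≡ D - r
    β₁≡D-r = begin
      R₁ · ((j + 1ℤ) ⊛ ℓ ⊖ m)           ≡⟨ ·-⊖ʳ R₁ ((j + 1ℤ) ⊛ ℓ) m ⟩
      R₁ · ((j + 1ℤ) ⊛ ℓ) - R₁ · m      ≡⟨ cong₂ _-_ (·-⊛ʳ R₁ (j + 1ℤ) ℓ) (DivMod.a≡a%n+[a/n]*n (R₁ · m) D) ⟩
      (j + 1ℤ) * D - (r + j * D)        ≡⟨ cancel j D r ⟩
      D - r                             ∎
      where
      open ≡-Reasoning
      cancel : ∀ j D r → (j + 1ℤ) * D - (r + j * D) ≡ D - r
      cancel = solve-∀
    -- r = 0 would put R₁ on the ray through (0,1), of level 1.
    1≤r : 1ℤ ≤ r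
    1≤r = ≰0⇒1≤ λ r≤0 → absent-below-L B 1ℤ 1ℤ weights {0ℤ} {1ℤ} 1<L (λ ())
      (ConvexWithOrigin.ray (Y[]-convex B) (Y[]-origin B) {T = 0ℤ , 1ℤ} 1≤D
        (subst Y[ B ] (cong₂ _,_ (trans α₁≡r (trans (ℤP.≤-antisym r≤0 (+≤+ z≤n)) (sym (ℤP.*-zeroʳ D))))
                                  (trans β₁≡D-r (trans (cong (_-_ D) (ℤP.≤-antisym r≤0 (+≤+ z≤n))) (shift D))))
                      (Y⇒Y[] B Y-R₁)))
      where
      shift : ∀ D → D - 0ℤ ≡ D * 1ℤ
      shift = solve-∀

  module _ (d : ℤ) (w<d : w < d) (wide : WideFromOrigin Y d) where

    1+w≤d : 1ℤ + w ≤ d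
    1+w≤d = ℤP.i<j⇒suc[i]≤j w<d

    1≤d : 1ℤ ≤ d
    1≤d = ℤP.≤-trans (i≤i+j 1ℤ 0≤w) 1+w≤d
      where
      0≤w : 0ℤ ≤ w
      0≤w = subst (0ℤ ≤_) (cancel L w) (0≤j-i (ℤP.≤-trans (proj₁ (level R₁ Y-R₁ R₁≢0)) (proj₂ (level R₁ Y-R₁ R₁≢0))))
        where
        cancel : ∀ L w → L + w - L ≡ w
        cancel = solve-∀

    -- The constraint b + c ≥ L turns the level bound b x + c y ≤ L + w < L + d into x + y ≤ d + 1.
    sum-bound : (F : Frame) → L ≤ weight F → ∀ R → Y R → R ≢ origin → R · u₁ (basis F) + R · u₂ (basis F) ≤ d + 1ℤ
    sum-bound (frame B b c 1≤b 1≤c weights positive) L≤b+c R yR R≢0 =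
      ≤-byDifference _ (slack d w L b c α β)
        (0≤i+j (0≤i+j (0≤i+j (0≤i+j (0≤j-i 1+w≤d) (0≤j-i upper)) (0≤j-i L≤b+c))
               (0≤i*j (0≤j-i 1≤b) (0≤j-i 1≤α))) (0≤i*j (0≤j-i 1≤c) (0≤j-i 1≤β)))
      where
      α = R · u₁ B
      β = R · u₂ B
      1≤α = proj₁ (positive R yR R≢0)
      1≤β = proj₂ (positive R yR R≢0)
      upper : b * α + c * β ≤ L + w
      upper = subst (_≤ L + w) (level-coords B b c weights R) (proj₂ (level R yR R≢0))
      slack : ∀ d w L b c α β → d + 1ℤ - (α + β) ≡
        d - (1ℤ + w) + (L + w - (b * α + c * β)) + (b + c - L) + (b - 1ℤ) * (α - 1ℤ) + (c - 1ℤ) * (β - 1ℤ)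
      slack = solve-∀

    corner : (F : Frame) → L ≤ weight F → ∀ R → Y R → d ≤ R · u₁ (basis F) → coords (basis F) R ≡ (d , 1ℤ)
    corner F L≤b+c R yR d≤α = cong₂ _,_ (ℤP.≤-antisym α≤d d≤α) (ℤP.≤-antisym β≤1 1≤β)
      where
      B = basis F
      α = R · u₁ B
      β = R · u₂ B
      R≢0 : R ≢ origin
      R≢0 refl = ℤP.<-irrefl refl (ℤP.<-≤-trans (1≤⇒0< 1≤d) (subst (d ≤_) (origin-· (u₁ B)) d≤α))
      1≤β = proj₂ (Frame.positive F R yR R≢0)
      room : 0ℤ ≤ d + 1ℤ - (α + β)
      room = 0≤j-i (sum-bound F L≤b+c R yR R≢0)
      α≤d : α ≤ d
      α≤d = ≤-byDifference _ (split d α β) (0≤i+j room (0≤j-i 1≤β))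
        where
        split : ∀ d α β → d - α ≡ d + 1ℤ - (α + β) + (β - 1ℤ)
        split = solve-∀
      β≤1 : β ≤ 1ℤ
      β≤1 = ≤-byDifference _ (split d α β) (0≤i+j room (0≤j-i d≤α))
        where
        split : ∀ d α β → 1ℤ - β ≡ d + 1ℤ - (α + β) + (α - d)
        split = solve-∀

    minimum-at-origin : (F : Frame) → ∀ R → Y R → 0ℤ ≤ R · u₁ (basis F)
    minimum-at-origin F R yR with R ≟ₚ origin
    ... | yes refl = ℤP.≤-reflexive (sym (origin-· (u₁ (basis F))))
    ... | no R≢0 = 1≤⇒0≤ (proj₁ (Frame.positive F R yR R≢0))

    far-corner : (F : Frame) → L ≤ weight F → Σ Pt λ R → Y R × coords (basis F) R ≡ (d , 1ℤ)
    far-corner F L≤b+c with wide (u₁ (basis F)) (u₁-primitive (basis F)) (minimum-at-origin F)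
    ... | R , yR , d≤α = R , yR , corner F L≤b+c R yR d≤α

    Υ-point-coords : (F : Frame) → L ≤ weight F → ∀ R → Y R ⇔ Υ-point d (coords (basis F) R)
    Υ-point-coords F L≤b+c R = mk⇔ to from
      where
      B = basis F
      to : Y R → Υ-point d (coords B R)
      to yR with R ≟ₚ origin
      ... | yes refl = inj₁ (cong₂ _,_ (origin-· (u₁ B)) (origin-· (u₂ B)))
      ... | no R≢0 = inj₂ (proj₁ (Frame.positive F R yR R≢0) , proj₂ (Frame.positive F R yR R≢0) , sum-bound F L≤b+c R yR R≢0)
      corner₁ : Y[ B ] (d , 1ℤ)
      corner₁ = let (R , yR , eq) = far-corner F L≤b+c in subst Y[ B ] eq (Y⇒Y[] B yR)
      corner₂ : Y[ B ] (1ℤ , d)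
      corner₂ = let (R , yR , eq) = far-corner (swap-frame F) (subst (L ≤_) (ℤP.+-comm (Frame.b F) (Frame.c F)) L≤b+c)
                in subst Y[ B ] (cong swapPt eq) (Y⇒Y[] B yR)
      from : Υ-point d (coords B R) → Y R
      from hR = subst Y (coords⁻¹-coords B R)
        (ConvexWithOrigin.Υ-fill (Y[]-convex B) (Y[]-origin B) 1≤d corner₁ corner₂ (coords B R) hR)

    Υ-normal-form : Σ Basis λ B → ∀ R → Y R ⇔ Υ-point d (coords B R)
    Υ-normal-form = basis (proj₁ final) , Υ-point-coords (proj₁ final) (proj₂ final)
      where
      final = iterate ∣ L ∣ initial (subst (λ t → L ≤ + 2 + t) (sym (ℤP.0≤i⇒+∣i∣≡i (ℤP.≤-trans (+≤+ z≤n) 2≤L))) (ℤP.i≤j+i L (+ 2)))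


-- Lattice widths

WidthIs-neg : ∀ {A v w} → WidthIs A v w → WidthIs A (neg v) w
WidthIs-neg {A} {v} {w} (p , q , Ap , Aq , bounds , w≡) =
  q , p , Aq , Ap , (λ r Ar → flip r q (proj₂ (bounds r Ar)) , flip p r (proj₁ (bounds r Ar))) ,
  trans w≡ (trans (swap-difference (q · v) (p · v)) (sym (cong₂ _-_ (·-neg p v) (·-neg q v))))
  where
  flip : ∀ r s → r · v ≤ s · v → s · neg v ≤ r · neg v
  flip r s le = subst₂ _≤_ (sym (·-neg s v)) (sym (·-neg r v)) (ℤP.neg-mono-≤ le)
  swap-difference : ∀ a b → a - b ≡ - b - - a
  swap-difference = solve-∀

WidthIs-translate : ∀ {X : PtSet} P {v w} → WidthIs X v w → WidthIs (λ R → X (P ⊕ R)) v w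
WidthIs-translate {X} P {v} {w} (p , q , Xp , Xq , bounds , w≡) =
  p ⊖ P , q ⊖ P , subst X (sym (⊕-⊖-cancel P p)) Xp , subst X (sym (⊕-⊖-cancel P q)) Xq ,
  (λ r Xr → subst₂ _≤_ (sym (·-⊖ p P v)) (·-⊕-relative P r v) (lower (proj₁ (bounds (P ⊕ r) Xr))) ,
            subst₂ _≤_ (·-⊕-relative P r v) (sym (·-⊖ q P v)) (lower (proj₂ (bounds (P ⊕ r) Xr)))) ,
  trans w≡ (trans (sym (cancel (q · v) (p · v) (P · v))) (sym (cong₂ _-_ (·-⊖ q P v) (·-⊖ p P v))))
  where
  lower : ∀ {i j} → i ≤ j → i - P · v ≤ j - P · v
  lower = ℤP.+-monoˡ-≤ (- (P · v))
  cancel : ∀ a b c → a - c - (b - c) ≡ a - b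
  cancel = solve-∀

strip-above : ∀ {Y Y⁻ : PtSet} {v w w′ q′} → (∀ R → Y R → R ≢ origin → Y⁻ R) → WidthIs Y⁻ v w →
              Y q′ → w′ ≡ q′ · v → w < w′ - 1ℤ → Σ ℤ λ L → + 2 ≤ L × LevelStrip Y v L w
strip-above {Y} {v = v} {w} {w′} {q′} ⊆⁻ (p , q , _ , Y⁻q , bounds , w≡) Yq′ w′≡ gap =
  p · v , 2≤p·v , λ R YR R≢0 → proj₁ (bounds R (⊆⁻ R YR R≢0)) , subst (R · v ≤_) q·v≡ (proj₂ (bounds R (⊆⁻ R YR R≢0)))
  where
  q·v≡ : q · v ≡ p · v + w
  q·v≡ = trans (sym (cancel (q · v) (p · v))) (cong (_+_ (p · v)) (sym w≡))
    where
    cancel : ∀ a b → b + (a - b) ≡ a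
    cancel = solve-∀
  1+w≤w′-1 = ℤP.i<j⇒suc[i]≤j gap
  2≤p·v : + 2 ≤ p · v
  2≤p·v with q′ ≟ₚ origin
  ... | yes refl = ⊥-elim (ℤP.<-irrefl refl (ℤP.<-≤-trans gap (subst (λ t → t - 1ℤ ≤ w) (sym (trans w′≡ (origin-· v)))
                                                                        (ℤP.≤-trans ℤ.-≤+ 0≤w))))
    where
    0≤w : 0ℤ ≤ w
    0≤w = subst (0ℤ ≤_) (sym w≡) (0≤j-i (proj₁ (bounds q Y⁻q)))
  ... | no q′≢0 = ≤-byDifference _ (slack (p · v) (q · v) (q′ · v) w w′ w≡ w′≡) (0≤i+j (0≤j-i 1+w≤w′-1) (0≤j-i (proj₂ (bounds q′ (⊆⁻ q′ Yq′ q′≢0)))))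
    where
    slack : ∀ a b c w w′ → w ≡ b - a → w′ ≡ c → a - + 2 ≡ w′ - 1ℤ - (1ℤ + w) + (b - c)
    slack a b c _ _ refl refl = regroup a b c
      where
      regroup : ∀ a b c → a - + 2 ≡ c - 1ℤ - (1ℤ + (b - a)) + (b - c)
      regroup = solve-∀

strip-from-width-drop : ∀ {Y Y⁻ : PtSet} {v w w′} → (∀ R → Y R → R ≢ origin → Y⁻ R) → Primitive v →
  WidthIs Y⁻ v w → WidthIs Y v w′ → w < w′ - 1ℤ → Σ Pt λ ℓ → Primitive ℓ × Σ ℤ λ L → + 2 ≤ L × LevelStrip Y ℓ L w
strip-from-width-drop {v = v} {w} {w′} ⊆⁻ prim width⁻@(p , q , _ , _ , bounds , w≡) (p′ , q′ , Yp′ , Yq′ , bounds′ , w′≡) gap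
  with p′ ≟ₚ origin | q′ ≟ₚ origin
... | yes refl | _ =
  v , prim , strip-above ⊆⁻ width⁻ Yq′ (trans w′≡ (trans (cong (_-_ (q′ · v)) (origin-· v)) (ℤP.+-identityʳ _))) gap
... | no _ | yes refl =
  neg v , Primitive-neg {v} prim ,
  strip-above ⊆⁻ (WidthIs-neg width⁻) Yp′ (trans w′≡ (trans (cong (_- p′ · v) (origin-· v)) (trans (ℤP.+-identityˡ _) (sym (·-neg p′ v))))) gap
... | no p′≢0 | no q′≢0 = ⊥-elim (ℤP.<-irrefl refl (ℤP.<-≤-trans gap (ℤP.≤-trans (ℤP.i-j≤i w′ 1ℤ) w′≤w)))
  where
  w′≤w : w′ ≤ w
  w′≤w = ≤-byDifference _ (trans (cong₂ _-_ w≡ w′≡) (regroup (p · v) (q · v) (p′ · v) (q′ · v)))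
           (0≤i+j (0≤j-i (proj₂ (bounds q′ (⊆⁻ q′ Yq′ q′≢0)))) (0≤j-i (proj₁ (bounds p′ (⊆⁻ p′ Yp′ p′≢0)))))
    where
    regroup : ∀ a b a′ b′ → b - a - (b′ - a′) ≡ b - b′ + (a′ - a)
    regroup = solve-∀

UnimodEquiv-fromCoords : ∀ {X Z : PtSet} P B → (∀ R → X (P ⊕ R) ⇔ Z (coords B R)) → UnimodEquiv X Z
UnimodEquiv-fromCoords {X} {Z} P@(p₁ , p₂) B@(mkBasis (a , b) (c , e) uni) equiv =
  a , b , c , e , (- (P · (a , b)) , - (P · (c , e))) , uni ,
  λ x y → subst₂ (λ s t → X s ⇔ Z t) (⊕-⊖-cancel P (x , y)) (cong₂ _,_ (affine a b x y) (affine c e x y)) (equiv ((x , y) ⊖ P))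
  where
  affine : ∀ a b x y → (x - p₁) * a + (y - p₂) * b ≡ a * x + b * y + - (p₁ * a + p₂ * b)
  affine a b x y = regroup a b x y p₁ p₂
    where
    regroup : ∀ a b x y p₁ p₂ → (x - p₁) * a + (y - p₂) * b ≡ a * x + b * y + - (p₁ * a + p₂ * b)
    regroup = solve-∀

width-drop⇒Υ-normal-form :
  ∀ {X X⁻ : PtSet} {P Q v w w′ d} → IsConvex X → X P → X Q → Q ≢ P → (∀ R → X R → R ≢ P → X⁻ R) →
  Primitive v → WidthIs X⁻ v w → WidthIs X v w′ → w < w′ - 1ℤ → w < d →
  WideFromOrigin (λ R → X (P ⊕ R)) d → Σ Basis λ B → ∀ R → X (P ⊕ R) ⇔ Υ-point d (coords B R)
width-drop⇒Υ-normal-form {X} {X⁻} {P} {Q} {d = d} convex XP XQ Q≢P ⊆⁻ v-primitive width⁻ width w<w′-1 w<d wide =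
    let (ℓ , ℓ-primitive , L , 2≤L , level) = strip in
    Strip.Υ-normal-form Y (IsConvex-translate convex P) (subst X (sym (⊕-origin P)) XP)
      ℓ ℓ-primitive L _ 2≤L level (Q ⊖ P) (subst X (sym (⊕-⊖-cancel P Q)) XQ) (⊖-≢ Q≢P) d w<d wide
  where
  Y : PtSet
  Y R = X (P ⊕ R)
  strip = strip-from-width-drop {Y} {λ R → X⁻ (P ⊕ R)} (λ R XR R≢0 → ⊆⁻ (P ⊕ R) XR (⊕-≢ R≢0)) v-primitive
            (WidthIs-translate P width⁻) (WidthIs-translate P width) w<w′-1

far-point : ∀ {n} (S : Vec Pt (suc n)) {d} P → LatPts S P → (∀ u w → Primitive u → WidthIs (LatPts S) u w → d ≤ w) →
            WideFromOrigin (λ R → LatPts S (P ⊕ R)) d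
far-point S {d} P XP lw-min u prim P-min with argmax S u
... | q , q∈S , q-max =
  q ⊖ P , subst (LatPts S) (sym (⊕-⊖-cancel P q)) Xq ,
  subst (d ≤_) (sym (·-⊖ q P u)) (lw-min u (q · u - P · u) prim (P , q , XP , Xq , bounds , refl))
  where
  Xq = ⊆-InConv q∈S
  bounds : ∀ r → LatPts S r → P · u ≤ r · u × r · u ≤ q · u
  bounds r Xr = ℤP.0≤i-j⇒j≤i (subst (0ℤ ≤_) (·-⊖ r P u) (P-min (r ⊖ P) (subst (LatPts S) (sym (⊕-⊖-cancel P r)) Xr))) ,
                InConv-≤ u (q · u) q-max Xr

lemma2p2 : ∀ {n} (S : Vec Pt (suc n)) (d : ℤ) → LwIs (LatPts S) d → 0ℤ < d →
    ∀ (P v : Pt) → IsVertex S P → Primitive v →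
    ∀ (w w′ : ℤ) → WidthIs (LatPtsMinus S P) v w → WidthIs (LatPts S) v w′ →
    w < d → w < w′ - 1ℤ →
    UnimodEquiv (LatPts S) (LatPts (Upsilon d))
lemma2p2 S d (_ , lw-min) 0<d P v (P∈S , _) v-primitive w w′ width⁻@(_ , _ , p∈Δ_P , _) width w<d w<w′-1 =
  UnimodEquiv-fromCoords {LatPts S} {LatPts (Upsilon d)} P B
    (λ R → ⇔-sym (LatPts-Upsilon⇔ (ℤP.i<j⇒suc[i]≤j 0<d) (coords B R)) ⇔-∘ equiv R)
  where
  XP = ⊆-InConv P∈S
  Q₁ = InConv-inhabited p∈Δ_P
  normal-form = width-drop⇒Υ-normal-form {LatPts S} {LatPtsMinus S P} {P} {proj₁ Q₁} {v} {w} {w′} {d}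
                  (InConv-convex _) XP (proj₁ (proj₂ Q₁)) (proj₂ (proj₂ Q₁))
                  (λ R XR R≢P → ⊆-InConv (XR , R≢P)) v-primitive width⁻ width w<w′-1 w<d (far-point S P XP lw-min)
  B = proj₁ normal-form
  equiv = proj₂ normal-form
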